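{- Let $G$ be a strongly connected ribbon digraph and let $(x,\varrho)$ be a recurrent divisor-and-rotor configuration. Then for any nonempty legal game transforming $(x,\varrho)$ back to itself, there is an integer $k\in\mathbb{N}$ such that each vertex $v$ is routed exactly $k\cdot d^+(v)\cdot{\rm per}_G(v)$ times in this game. Moreover, there always exists a legal game transforming $(x,\varrho)$ back to itself in which each vertex $v$ is routed exactly $d^+(v)\cdot{\rm per}_G(v)$ times.
   Context: A digraph here is strongly connected, may have multiple edges, and has no loops; $d^+(v)$ is the out-degree of $v$ and $d(u,v)$ the multiplicity of edge $\overrightarrow{uv}$. The Laplacian $L_G\in\mathbb{Z}^{V(G)\times V(G)}$ has $L_G(v,v)=-d^+(v)$ and $L_G(u,v)=d(v,u)$ for $u\neq v$. ${\rm per}_G$ denotes the unique vector in $\mathbb{Z}^{V(G)}$ with strictly positive, relatively prime entries satisfying $L_G{\rm per}_G=\mathbf{0}$. A ribbon digraph is a digraph with, for each vertex $v$, a fixed cyclic ordering of the edges leaving $v$; $e^+$ denotes the edge after $e$ in this order. A divisor is $x\in\mathbb{Z}^{V(G)}$. A rotor configuration $\varrho$ assigns to each vertex $v$ an edge $\varrho(v)$ with tail $v$. A divisor-and-rotor configuration (DRC) is a pair $(x,\varrho)$. Routing at $v$ transforms $(x,\varrho)$ into $(x',\varrho')$ with $\varrho'(v)=\varrho(v)^+$, $\varrho'(u)=\varrho(u)$ for $u\ne v$, and $x'=x-\mathbf{1}_v+\mathbf{1}_{v'}$ where $v'$ is the head of $\varrho(v)^+$; it is legal if $x(v)>0$.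 A legal game is a sequence of configurations each obtained from the previous by a legal routing. A DRC is recurrent if some legal game with at least one routing leads from it back to itself. -}

module Defs where

open import Data.Nat as ℕ using (ℕ; zero; suc; _<?_)
open import Data.Nat.Divisibility using (_∣_)
open import Data.Integer as ℤ using (ℤ; +_; _+_; _-_; -_; ∣_∣; _<_)
open import Data.Fin as Fin using (Fin; zero; suc; fromℕ<; toℕ)
open import Data.List using (List; []; _∷_)
open import Data.Product using (_×_; Σ; ∃-syntax; _,_)
open import Data.Unit using (⊤)
open import Data.Bool using (Bool; if_then_else_)
open import Relation.Nullary using (¬_; yes; no)
open import Relation.Nullary.Decidable using (⌊_⌋)
open import Relation.Binary.PropositionalEquality using (_≡_; _≢_)

-- The edges leaving v are indexed by
-- Fin (outdeg v), listed in their fixed cyclic order (edge i is followed by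
-- edge i+1 mod outdeg v); head v i is the head of the i-th edge leaving v.
-- Multiple edges are allowed (head need not be injective); no loops.
record RibbonDigraph : Set where
  field
    n        : ℕ
    outdeg   : Fin n → ℕ
    head     : (v : Fin n) → Fin (outdeg v) → Fin n
    loopless : ∀ v i → head v i ≢ v

module _ (G : RibbonDigraph) where
  open RibbonDigraph G

  V : Set
  V = Fin n

  data Reach : V → V → Set where
    here : ∀ {v} → Reach v v
    step : ∀ {u w} (i : Fin (outdeg u)) → Reach (head u i) w → Reach u w

  StronglyConnected : Set
  StronglyConnected = ∀ u v → Reach u v

next : ∀ {d} → Fin d → Fin d
next {suc m} i with suc (toℕ i) <? suc m
... | yes p = fromℕ< p
... | no _  = zero

sumℕ : ∀ {m} → (Fin m → ℕ) → ℕ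
sumℕ {zero}  f = 0
sumℕ {suc m} f = f zero ℕ.+ sumℕ (λ i → f (suc i))

sumℤ : ∀ {m} → (Fin m → ℤ) → ℤ
sumℤ {zero}  f = + 0
sumℤ {suc m} f = f zero + sumℤ (λ i → f (suc i))

δ : ∀ {m} → Fin m → Fin m → ℤ
δ u v = if ⌊ u Fin.≟ v ⌋ then + 1 else + 0

module _ (G : RibbonDigraph) where
  open RibbonDigraph G

  mult : V G → V G → ℕ
  mult v u = sumℕ (λ i → if ⌊ head v i Fin.≟ u ⌋ then 1 else 0)

  Laplacian : V G → V G → ℤ
  Laplacian u v = if ⌊ u Fin.≟ v ⌋ then - (+ outdeg v) else + mult v u

  -- p = per_G : strictly positive, relatively prime entries, L p = 0
  -- (per_G is the unique such vector)
  IsPer : (V G → ℤ) → Set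
  IsPer p = (∀ v → + 0 < p v)
          × (∀ (d : ℕ) → (∀ v → d ∣ ∣ p v ∣) → d ≡ 1)
          × (∀ u → sumℤ (λ v → Laplacian u v ℤ.* p v) ≡ + 0)

  record DRC : Set where
    constructor drc
    field
      div   : V G → ℤ
      rotor : (v : V G) → Fin (outdeg v)
  open DRC public

  route : DRC → V G → DRC
  route (drc x ρ) v = drc x' ρ'
    where
      e⁺ : Fin (outdeg v)
      e⁺ = next (ρ v)
      x' : V G → ℤ
      x' u = x u - δ u v + δ u (head v e⁺)
      ρ' : (u : V G) → Fin (outdeg u)
      ρ' u with u Fin.≟ v
      ... | yes Relation.Binary.PropositionalEquality.refl = e⁺
      ... | no _ = ρ u

  run : DRC → List (V G) → DRC
  run c []       = c
  run c (v ∷ ws) = run (route c v) ws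

  Legal : DRC → List (V G) → Set
  Legal c []       = ⊤
  Legal c (v ∷ ws) = (+ 0 < div c v) × Legal (route c v) ws

  _≈_ : DRC → DRC → Set
  c ≈ c' = (∀ v → div c v ≡ div c' v) × (∀ v → rotor c v ≡ rotor c' v)

  occ : V G → List (V G) → ℕ
  occ v []       = 0
  occ v (w ∷ ws) = (if ⌊ v Fin.≟ w ⌋ then 1 else 0) ℕ.+ occ v ws

  Recurrent : DRC → Set
  Recurrent c = ∃[ ws ] (ws ≢ []) × Legal c ws × (run c ws ≈ c)

-- The configuration reached from c depends only on the routing counts m:
-- the rotor of v has advanced m(v) steps and the chips are c's, minus m, plus
-- what the first m(w) routings at each w sent along the edges (`after`).
-- A game returning to c therefore routes every v a whole number Q(v) of turns
-- (rotors come back) and Q is balanced, i.e. lies in the kernel of L_G (chips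
-- come back); on a strongly connected digraph the balanced natural vectors are
-- the multiples of per_G (compare Q/per_G with its minimum along edges).
-- Conversely, adding d⁺·y routings for a balanced y changes nothing, so
-- deleting from a legal game of k periods the first (k-1)·d⁺(v)·per_G(v)
-- routings at each v leaves a legal game of one period: every kept routing
-- finds at least as many chips as in the original game.

module Submission where

open import Defs
open import Data.Nat as ℕ using (ℕ; zero; suc; _∸_; z≤n; NonZero)
import Data.Nat.Properties as ℕP
open import Data.Nat.DivMod
  using (_%_; _/_; m<n⇒m%n≡m; n%n≡0; %-distribˡ-+; m%n%n≡m%n; [m+kn]%n≡m%n; m≡m%n+[m/n]*n; m/n*n≡m; m*[n/m]≡n)
open import Data.Nat.Divisibility using (_∣_; divides)
open import Data.Nat.GCD using (gcd; gcd[m,n]∣m; gcd[m,n]∣n; gcd[m,n]≢0)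
open import Data.Nat.Coprimality using (coprime-/gcd; coprime-divisor)
open import Data.Fin as Fin using (Fin; zero; suc; toℕ)
open import Data.Fin.Properties using (toℕ<n; toℕ-fromℕ<; toℕ-injective; suc-injective)
open import Data.Integer as ℤ using (ℤ; +_; _*_)
import Data.Integer.Properties as ℤP
open import Data.Integer.Tactic.RingSolver using (solve-∀)
open import Data.Nat.Tactic.RingSolver using () renaming (solve-∀ to ℕ-solve-∀)
open import Algebra.Properties.CommutativeSemigroup ℕP.+-commutativeSemigroup
  using () renaming (interchange to +-interchange; xy∙z≈xz∙y to +-right-comm;
                    x∙yz≈yx∙z to +-assoc-comm; xy∙z≈y∙xz to +-comm-assoc)
open import Algebra.Properties.CommutativeSemigroup ℤP.+-commutativeSemigroup
  using () renaming (xy∙z≈xz∙y to ℤ+-right-comm)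
open import Algebra.Properties.CommutativeSemigroup ℕP.*-commutativeSemigroup
  using () renaming (xy∙z≈xz∙y to *-right-comm; x∙yz≈y∙xz to *-left-comm)
open import Data.List using (List; []; _∷_)
open import Data.Unit using (tt)
open import Data.Product using (_×_; ∃-syntax; _,_; proj₁; proj₂)
open import Data.Sum using (inj₁)
open import Data.Bool using (true; false; if_then_else_)
open import Relation.Nullary using (¬_; yes; no; contradiction)
open import Relation.Nullary.Decidable using (⌊_⌋)
open import Relation.Binary.PropositionalEquality

+-squeeze : ∀ {a b c d} → a ℕ.≤ b → c ℕ.≤ d → a ℕ.+ c ≡ b ℕ.+ d → a ≡ b × c ≡ d
+-squeeze {a} {b} {c} {d} a≤b c≤d eq = a≡b , ℕP.+-cancelˡ-≡ a c d (trans eq (cong (ℕ._+ d) (sym a≡b)))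
  where
  a≡b : a ≡ b
  a≡b = ℕP.≤-antisym a≤b (ℕP.+-cancelʳ-≤ d b a (ℕP.≤-trans (ℕP.≤-reflexive (sym eq)) (ℕP.+-monoʳ-≤ a c≤d)))

sumℤ-cong : ∀ {k} {f g : Fin k → ℤ} → (∀ i → f i ≡ g i) → sumℤ f ≡ sumℤ g
sumℤ-cong {zero}  eq = refl
sumℤ-cong {suc k} eq = cong₂ ℤ._+_ (eq zero) (sumℤ-cong (λ i → eq (suc i)))

sumℕ-cong : ∀ {k} {f g : Fin k → ℕ} → (∀ i → f i ≡ g i) → sumℕ f ≡ sumℕ g
sumℕ-cong {zero}  eq = refl
sumℕ-cong {suc k} eq = cong₂ ℕ._+_ (eq zero) (sumℕ-cong (λ i → eq (suc i)))

sumℕ-+ : ∀ {k} (f g : Fin k → ℕ) → sumℕ (λ i → f i ℕ.+ g i) ≡ sumℕ f ℕ.+ sumℕ g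
sumℕ-+ {zero}  f g = refl
sumℕ-+ {suc k} f g = trans (cong (f zero ℕ.+ g zero ℕ.+_) (sumℕ-+ (λ i → f (suc i)) (λ i → g (suc i))))
                           (+-interchange (f zero) (g zero) _ _)

sumℕ-*ˡ : ∀ {k} a (f : Fin k → ℕ) → sumℕ (λ i → a ℕ.* f i) ≡ a ℕ.* sumℕ f
sumℕ-*ˡ {zero}  a f = sym (ℕP.*-zeroʳ a)
sumℕ-*ˡ {suc k} a f = trans (cong (a ℕ.* f zero ℕ.+_) (sumℕ-*ˡ a (λ i → f (suc i))))
                            (sym (ℕP.*-distribˡ-+ a (f zero) _))

sumℕ-update : ∀ {k} (f g : Fin k → ℕ) v e → (∀ w → w ≢ v → g w ≡ f w) → g v ≡ f v ℕ.+ e →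
              sumℕ g ≡ sumℕ f ℕ.+ e
sumℕ-update f g zero e same changed = trans (cong₂ ℕ._+_ changed (sumℕ-cong (λ i → same (suc i) λ ())))
                                           (+-right-comm (f zero) e _)
sumℕ-update f g (suc v) e same changed =
  trans (cong₂ ℕ._+_ (same zero λ ()) (sumℕ-update (λ i → f (suc i)) (λ i → g (suc i)) v e
                       (λ w w≢v → same (suc w) (λ eq → w≢v (suc-injective eq))) changed))
        (sym (ℕP.+-assoc (f zero) _ e))

sumℕ-mono : ∀ {k} {f g : Fin k → ℕ} → (∀ i → f i ℕ.≤ g i) → sumℕ f ℕ.≤ sumℕ g
sumℕ-mono {zero}  le = z≤n
sumℕ-mono {suc k} le = ℕP.+-mono-≤ (le zero) (sumℕ-mono (λ i → le (suc i)))

sumℕ-squeeze : ∀ {k} {f g : Fin k → ℕ} → (∀ i → f i ℕ.≤ g i) → sumℕ f ≡ sumℕ g → ∀ i → f i ≡ g i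
sumℕ-squeeze {suc k} le eq zero    = proj₁ (+-squeeze (le zero) (sumℕ-mono (λ i → le (suc i))) eq)
sumℕ-squeeze {suc k} le eq (suc i) = sumℕ-squeeze (λ j → le (suc j))
                                       (proj₂ (+-squeeze (le zero) (sumℕ-mono (λ j → le (suc j))) eq)) i

sumℤ-update : ∀ {k} (f g : Fin k → ℤ) v e → (∀ w → w ≢ v → g w ≡ f w) → g v ≡ f v ℤ.+ e →
              sumℤ g ≡ sumℤ f ℤ.+ e
sumℤ-update f g zero e same changed = trans (cong₂ ℤ._+_ changed (sumℤ-cong (λ i → same (suc i) λ ())))
                                           (ℤ+-right-comm (f zero) e _)
sumℤ-update f g (suc v) e same changed =
  trans (cong₂ ℤ._+_ (same zero λ ()) (sumℤ-update (λ i → f (suc i)) (λ i → g (suc i)) v e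
                       (λ w w≢v → same (suc w) (λ eq → w≢v (suc-injective eq))) changed))
        (sym (ℤP.+-assoc (f zero) _ e))

term≤sumℕ : ∀ {k} (f : Fin k → ℕ) i → f i ℕ.≤ sumℕ f
term≤sumℕ f zero    = ℕP.m≤m+n (f zero) _
term≤sumℕ f (suc i) = ℕP.≤-trans (term≤sumℕ (λ j → f (suc j)) i) (ℕP.m≤n+m _ (f zero))

sumℕ-zeros : ∀ k → sumℕ {k} (λ _ → 0) ≡ 0
sumℕ-zeros zero    = refl
sumℕ-zeros (suc k) = sumℕ-zeros k

sumℤ-pos : ∀ {k} (f : Fin k → ℕ) → sumℤ (λ i → + f i) ≡ + sumℕ f
sumℤ-pos {zero}  f = refl
sumℤ-pos {suc k} f = cong (ℤ._+_ (+ f zero)) (sumℤ-pos (λ i → f (suc i)))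

-- Cyclic order on the edges leaving a vertex.

advance : ∀ {d} → ℕ → Fin d → Fin d
advance zero    e = e
advance (suc j) e = next (advance j e)

suc-% : ∀ a n .{{_ : NonZero n}} → suc (a % n) % n ≡ suc a % n
suc-% a n = begin
  (1 ℕ.+ a % n) % n           ≡⟨ %-distribˡ-+ 1 (a % n) n ⟩
  (1 % n ℕ.+ a % n % n) % n   ≡⟨ cong (λ z → (1 % n ℕ.+ z) % n) (m%n%n≡m%n a n) ⟩
  (1 % n ℕ.+ a % n) % n       ≡⟨ %-distribˡ-+ 1 a n ⟨
  (1 ℕ.+ a) % n               ∎
  where open ≡-Reasoning

toℕ-next : ∀ {m} (e : Fin (suc m)) → toℕ (next e) ≡ suc (toℕ e) % suc m
toℕ-next {m} e with suc (toℕ e) ℕ.<? suc m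
... | yes lt = trans (toℕ-fromℕ< lt) (sym (m<n⇒m%n≡m lt))
... | no ¬lt = sym (trans (cong (_% suc m) wraps) (n%n≡0 (suc m)))
  where
  wraps : suc (toℕ e) ≡ suc m
  wraps = ℕP.≤-antisym (toℕ<n e) (ℕP.≮⇒≥ ¬lt)

toℕ-advance : ∀ {m} j (e : Fin (suc m)) → toℕ (advance j e) ≡ (toℕ e ℕ.+ j) % suc m
toℕ-advance {m} zero e = begin
  toℕ e                     ≡⟨ m<n⇒m%n≡m (toℕ<n e) ⟨
  toℕ e % suc m             ≡⟨ cong (_% suc m) (ℕP.+-identityʳ (toℕ e)) ⟨
  (toℕ e ℕ.+ 0) % suc m     ∎
  where open ≡-Reasoning
toℕ-advance {m} (suc j) e = begin
  toℕ (next (advance j e))          ≡⟨ toℕ-next (advance j e) ⟩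
  suc (toℕ (advance j e)) % suc m   ≡⟨ cong (λ z → suc z % suc m) (toℕ-advance j e) ⟩
  suc ((toℕ e ℕ.+ j) % suc m) % suc m ≡⟨ suc-% (toℕ e ℕ.+ j) (suc m) ⟩
  suc (toℕ e ℕ.+ j) % suc m         ≡⟨ cong (_% suc m) (ℕP.+-suc (toℕ e) j) ⟨
  (toℕ e ℕ.+ suc j) % suc m         ∎
  where open ≡-Reasoning

advance-+ : ∀ {d} a b (e : Fin d) → advance a (advance b e) ≡ advance (a ℕ.+ b) e
advance-+ zero    b e = refl
advance-+ (suc a) b e = cong next (advance-+ a b e)

advance-next : ∀ {d} j (e : Fin d) → advance j (next e) ≡ next (advance j e)
advance-next j e = trans (advance-+ j 1 e) (cong (λ z → advance z e) (ℕP.+-comm j 1))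

advance-turns : ∀ {d} q (e : Fin d) → advance (q ℕ.* d) e ≡ e
advance-turns {suc m} q e = toℕ-injective (begin
  toℕ (advance (q ℕ.* suc m) e)      ≡⟨ toℕ-advance (q ℕ.* suc m) e ⟩
  (toℕ e ℕ.+ q ℕ.* suc m) % suc m    ≡⟨ [m+kn]%n≡m%n (toℕ e) q (suc m) ⟩
  toℕ e % suc m                      ≡⟨ m<n⇒m%n≡m (toℕ<n e) ⟩
  toℕ e                              ∎)
  where open ≡-Reasoning

advance-turn : ∀ {d} (e : Fin d) → advance d e ≡ e
advance-turn {d} e = trans (cong (λ z → advance z e) (sym (ℕP.*-identityˡ d))) (advance-turns 1 e)

advance-returns : ∀ {d} j (e : Fin d) → advance j e ≡ e → ∃[ q ] j ≡ q ℕ.* d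
advance-returns {suc m} j e back = (toℕ e ℕ.+ j) / suc m , ℕP.+-cancelˡ-≡ (toℕ e) _ _ (begin
  toℕ e ℕ.+ j                                   ≡⟨ m≡m%n+[m/n]*n (toℕ e ℕ.+ j) (suc m) ⟩
  (toℕ e ℕ.+ j) % suc m ℕ.+ (toℕ e ℕ.+ j) / suc m ℕ.* suc m
    ≡⟨ cong (ℕ._+ (toℕ e ℕ.+ j) / suc m ℕ.* suc m) (trans (sym (toℕ-advance j e)) (cong toℕ back)) ⟩
  toℕ e ℕ.+ (toℕ e ℕ.+ j) / suc m ℕ.* suc m     ∎)
  where open ≡-Reasoning

advance-from-zero : ∀ {m} (e : Fin (suc m)) → advance (toℕ e) zero ≡ e
advance-from-zero e = toℕ-injective (trans (toℕ-advance (toℕ e) zero) (m<n⇒m%n≡m (toℕ<n e)))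

Σ< : (ℕ → ℕ) → ℕ → ℕ
Σ< h zero    = 0
Σ< h (suc j) = h 0 ℕ.+ Σ< (λ s → h (suc s)) j

Σ<-cong : ∀ {h h'} → (∀ s → h s ≡ h' s) → ∀ j → Σ< h j ≡ Σ< h' j
Σ<-cong eq zero    = refl
Σ<-cong eq (suc j) = cong₂ ℕ._+_ (eq 0) (Σ<-cong (λ s → eq (suc s)) j)

Σ<-split : ∀ h j k → Σ< h (j ℕ.+ k) ≡ Σ< h j ℕ.+ Σ< (λ s → h (j ℕ.+ s)) k
Σ<-split h zero    k = refl
Σ<-split h (suc j) k = trans (cong (h 0 ℕ.+_) (Σ<-split (λ s → h (suc s)) j k))
                             (sym (ℕP.+-assoc (h 0) _ _))

Σ<-toℕ : ∀ {m} (h : ℕ → ℕ) → Σ< h m ≡ sumℕ (λ (i : Fin m) → h (toℕ i))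
Σ<-toℕ {zero}  h = refl
Σ<-toℕ {suc m} h = cong (h 0 ℕ.+_) (Σ<-toℕ {m} (λ s → h (suc s)))

orbitSum : ∀ {d} → (Fin d → ℕ) → Fin d → ℕ → ℕ
orbitSum g e = Σ< (λ s → g (advance s e))

orbitSum-+ : ∀ {d} (g : Fin d → ℕ) e j k →
             orbitSum g e (j ℕ.+ k) ≡ orbitSum g e j ℕ.+ orbitSum g (advance j e) k
orbitSum-+ g e j k = trans (Σ<-split _ j k) (cong (orbitSum g e j ℕ.+_) (Σ<-cong shift k))
  where
  shift : ∀ s → g (advance (j ℕ.+ s) e) ≡ g (advance s (advance j e))
  shift s = cong g (trans (cong (λ z → advance z e) (ℕP.+-comm j s)) (sym (advance-+ s j e)))

orbitSum-mono : ∀ {d} (g : Fin d → ℕ) e {j j'} → j ℕ.≤ j' → orbitSum g e j ℕ.≤ orbitSum g e j'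
orbitSum-mono g e {j} {j'} j≤j' = begin
  orbitSum g e j                                        ≤⟨ ℕP.m≤m+n _ _ ⟩
  orbitSum g e j ℕ.+ orbitSum g (advance j e) (j' ∸ j)  ≡⟨ orbitSum-+ g e j (j' ∸ j) ⟨
  orbitSum g e (j ℕ.+ (j' ∸ j))                         ≡⟨ cong (orbitSum g e) (ℕP.m+[n∸m]≡n j≤j') ⟩
  orbitSum g e j'                                       ∎
  where open ℕP.≤-Reasoning

orbitSum-suc : ∀ {d} (g : Fin d → ℕ) e j → orbitSum g e (suc j) ≡ orbitSum g e j ℕ.+ g (advance j e)
orbitSum-suc g e j = begin
  orbitSum g e (suc j)                          ≡⟨ cong (orbitSum g e) (ℕP.+-comm 1 j) ⟩
  orbitSum g e (j ℕ.+ 1)                        ≡⟨ orbitSum-+ g e j 1 ⟩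
  orbitSum g e j ℕ.+ (g (advance j e) ℕ.+ 0)    ≡⟨ cong (orbitSum g e j ℕ.+_) (ℕP.+-identityʳ _) ⟩
  orbitSum g e j ℕ.+ g (advance j e)            ∎
  where open ≡-Reasoning

orbitSum-turn : ∀ {d} (g : Fin d → ℕ) e → orbitSum g e d ≡ sumℕ g
orbitSum-turn {suc m} g e = begin
  orbitSum g e (suc m)                      ≡⟨ cong (λ z → orbitSum g z (suc m)) (advance-from-zero e) ⟨
  orbitSum g (advance (toℕ e) zero) (suc m) ≡⟨ rotation (toℕ e) zero ⟩
  orbitSum g zero (suc m)                   ≡⟨ Σ<-toℕ {suc m} (λ s → g (advance s zero)) ⟩
  sumℕ (λ (i : Fin (suc m)) → g (advance (toℕ i) zero))     ≡⟨ sumℕ-cong (λ i → cong g (advance-from-zero i)) ⟩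
  sumℕ g                                    ∎
  where
  open ≡-Reasoning
  -- Both ways of splitting j + d = d + j leave the same full-turn sum.
  rotation : ∀ j e → orbitSum g (advance j e) (suc m) ≡ orbitSum g e (suc m)
  rotation j e = ℕP.+-cancelˡ-≡ (orbitSum g e j) _ _ (begin
    orbitSum g e j ℕ.+ orbitSum g (advance j e) (suc m)  ≡⟨ orbitSum-+ g e j (suc m) ⟨
    orbitSum g e (j ℕ.+ suc m)                           ≡⟨ cong (orbitSum g e) (ℕP.+-comm j (suc m)) ⟩
    orbitSum g e (suc m ℕ.+ j)                           ≡⟨ orbitSum-+ g e (suc m) j ⟩
    orbitSum g e (suc m) ℕ.+ orbitSum g (advance (suc m) e) j
      ≡⟨ cong (λ z → orbitSum g e (suc m) ℕ.+ orbitSum g z j) (advance-turn e) ⟩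
    orbitSum g e (suc m) ℕ.+ orbitSum g e j              ≡⟨ ℕP.+-comm (orbitSum g e (suc m)) _ ⟩
    orbitSum g e j ℕ.+ orbitSum g e (suc m)              ∎)

orbitSum-turns : ∀ {d} (g : Fin d → ℕ) e j q →
                 orbitSum g e (j ℕ.+ q ℕ.* d) ≡ orbitSum g e j ℕ.+ q ℕ.* sumℕ g
orbitSum-turns {d} g e j q = trans (orbitSum-+ g e j (q ℕ.* d)) (cong (orbitSum g e j ℕ.+_) (turns q (advance j e)))
  where
  turns : ∀ q e → orbitSum g e (q ℕ.* d) ≡ q ℕ.* sumℕ g
  turns zero    e = refl
  turns (suc q) e = begin
    orbitSum g e (d ℕ.+ q ℕ.* d)                      ≡⟨ orbitSum-+ g e d (q ℕ.* d) ⟩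
    orbitSum g e d ℕ.+ orbitSum g (advance d e) (q ℕ.* d) ≡⟨ cong₂ ℕ._+_ (orbitSum-turn g e) (turns q (advance d e)) ⟩
    sumℕ g ℕ.+ q ℕ.* sumℕ g                           ∎
    where open ≡-Reasoning

if-≡ : ∀ {k} {A : Set} {a b : Fin k} (x y : A) → a ≡ b → (if ⌊ a Fin.≟ b ⌋ then x else y) ≡ x
if-≡ {a = a} x y refl with a Fin.≟ a
... | yes _  = refl
... | no a≢a = contradiction refl a≢a

if-≢ : ∀ {k} {A : Set} {a b : Fin k} (x y : A) → a ≢ b → (if ⌊ a Fin.≟ b ⌋ then x else y) ≡ y
if-≢ {a = a} {b} x y a≢b with a Fin.≟ b
... | yes a≡b = contradiction a≡b a≢b
... | no _    = refl

ind : ∀ {k} → Fin k → Fin k → ℕ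
ind a b = if ⌊ a Fin.≟ b ⌋ then 1 else 0

ind-sym : ∀ {k} (a b : Fin k) → ind a b ≡ ind b a
ind-sym a b with a Fin.≟ b
... | yes refl = sym (if-≡ 1 0 refl)
... | no a≢b   = sym (if-≢ 1 0 (λ b≡a → a≢b (sym b≡a)))

δ≡ind : ∀ {k} (a b : Fin k) → δ a b ≡ + ind a b
δ≡ind a b = lift ⌊ a Fin.≟ b ⌋
  where
  lift : ∀ t → (if t then + 1 else + 0) ≡ + (if t then 1 else 0)
  lift true  = refl
  lift false = refl

-- Proportional vectors of naturals.

NoCommonDivisor : ∀ {I : Set} → (I → ℕ) → Set
NoCommonDivisor P = ∀ d → (∀ i → d ∣ P i) → d ≡ 1

proportional⇒multiple : ∀ {I : Set} (P Q : I → ℕ) A B .{{_ : NonZero A}} → NoCommonDivisor P →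
                        (∀ i → A ℕ.* Q i ≡ B ℕ.* P i) → ∃[ k ] (∀ i → Q i ≡ k ℕ.* P i)
proportional⇒multiple P Q A B noDivisor AQ≡BP = B / A , λ i → ℕP.*-cancelˡ-≡ (Q i) (B / A ℕ.* P i) A (begin
  A ℕ.* Q i                ≡⟨ AQ≡BP i ⟩
  B ℕ.* P i                ≡⟨ cong (ℕ._* P i) (m*[n/m]≡n A∣B) ⟨
  A ℕ.* (B / A) ℕ.* P i    ≡⟨ ℕP.*-assoc A (B / A) (P i) ⟩
  A ℕ.* (B / A ℕ.* P i)    ∎)
  where
  open ≡-Reasoning
  g : ℕ
  g = gcd A B
  instance
    g≢0 : NonZero g
    g≢0 = ℕ.≢-nonZero (gcd[m,n]≢0 A B (inj₁ (ℕ.≢-nonZero⁻¹ A)))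
  A′ B′ : ℕ
  A′ = A / g
  B′ = B / g
  A′g≡A : A′ ℕ.* g ≡ A
  A′g≡A = m/n*n≡m (gcd[m,n]∣m A B)
  B′g≡B : B′ ℕ.* g ≡ B
  B′g≡B = m/n*n≡m (gcd[m,n]∣n A B)
  -- Dividing A·Q = B·P by g = gcd(A,B) leaves A′·Q = B′·P with A′, B′ coprime, ...
  reduced : ∀ i → A′ ℕ.* Q i ≡ B′ ℕ.* P i
  reduced i = ℕP.*-cancelʳ-≡ (A′ ℕ.* Q i) (B′ ℕ.* P i) g (begin
    A′ ℕ.* Q i ℕ.* g   ≡⟨ *-right-comm A′ (Q i) g ⟩
    A′ ℕ.* g ℕ.* Q i   ≡⟨ cong (ℕ._* Q i) A′g≡A ⟩
    A ℕ.* Q i          ≡⟨ AQ≡BP i ⟩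
    B ℕ.* P i          ≡⟨ cong (ℕ._* P i) B′g≡B ⟨
    B′ ℕ.* g ℕ.* P i   ≡⟨ *-right-comm B′ g (P i) ⟩
    B′ ℕ.* P i ℕ.* g   ∎)
  -- ... so A′ divides every entry of P, hence A′ = 1 and A = g divides B.
  A′∣P : ∀ i → A′ ∣ P i
  A′∣P i = coprime-divisor (coprime-/gcd A B) (divides (Q i) (trans (sym (reduced i)) (ℕP.*-comm A′ (Q i))))
  A≡g : A ≡ g
  A≡g = begin
    A           ≡⟨ A′g≡A ⟨
    A′ ℕ.* g    ≡⟨ cong (ℕ._* g) (noDivisor A′ A′∣P) ⟩
    1 ℕ.* g     ≡⟨ ℕP.*-identityˡ g ⟩
    g           ∎
  A∣B : A ∣ B
  A∣B = subst (_∣ B) (sym A≡g) (gcd[m,n]∣n A B)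

ratio-trans : ∀ {a b c p q r} → 0 ℕ.< q → a ℕ.* q ℕ.≤ b ℕ.* p → b ℕ.* r ℕ.≤ c ℕ.* q → a ℕ.* r ℕ.≤ c ℕ.* p
ratio-trans {a} {b} {c} {p} {q} {r} 0<q ab bc = ℕP.*-cancelʳ-≤ (a ℕ.* r) (c ℕ.* p) q {{ℕ.>-nonZero 0<q}} (begin
  a ℕ.* r ℕ.* q   ≡⟨ *-right-comm a r q ⟩
  a ℕ.* q ℕ.* r   ≤⟨ ℕP.*-monoˡ-≤ r ab ⟩
  b ℕ.* p ℕ.* r   ≡⟨ *-right-comm b p r ⟩
  b ℕ.* r ℕ.* p   ≤⟨ ℕP.*-monoˡ-≤ p bc ⟩
  c ℕ.* q ℕ.* p   ≡⟨ *-right-comm c q p ⟩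
  c ℕ.* p ℕ.* q   ∎)
  where open ℕP.≤-Reasoning

minimal-ratio : ∀ {k} (P Q : Fin k → ℕ) → (∀ i → 0 ℕ.< P i) → Fin k →
                ∃[ i₀ ] (∀ i → Q i₀ ℕ.* P i ℕ.≤ Q i ℕ.* P i₀)
minimal-ratio {suc zero} P Q pos _ = zero , λ { zero → ℕP.≤-refl }
minimal-ratio {suc (suc k)} P Q pos _
  with minimal-ratio (λ i → P (suc i)) (λ i → Q (suc i)) (λ i → pos (suc i)) zero
... | i₁ , min₁ with Q zero ℕ.* P (suc i₁) ℕ.≤? Q (suc i₁) ℕ.* P zero
...   | yes zero≤i₁ = zero , λ { zero → ℕP.≤-refl
                               ; (suc i) → ratio-trans {Q zero} {Q (suc i₁)} {Q (suc i)} (pos (suc i₁)) zero≤i₁ (min₁ i) }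
...   | no  i₁<zero = suc i₁ , λ { zero → ℕP.<⇒≤ (ℕP.≰⇒> i₁<zero) ; (suc i) → min₁ i }

-- Balanced vectors: the kernel of the Laplacian.

module _ (G : RibbonDigraph) where
  open RibbonDigraph G

  hits : (w : V G) → V G → Fin (outdeg w) → ℕ
  hits w u i = ind (head w i) u

  -- y is balanced when, if every w sends y(w) chips along each of its edges,
  -- every u receives exactly as many chips, d⁺(u)·y(u), as it sends.
  Balanced : (V G → ℕ) → Set
  Balanced y = ∀ u → sumℕ (λ w → mult G w u ℕ.* y w) ≡ outdeg u ℕ.* y u

  -- Row u of L_G·y is the inflow at u minus the outflow d⁺(u)·y(u); the
  -- diagonal contributes nothing to the inflow since G has no loops.
  Laplacian-row : ∀ u (y : V G → ℕ) →
    sumℤ (λ v → Laplacian G u v ℤ.* + y v) ≡ + sumℕ (λ v → mult G v u ℕ.* y v) ℤ.- + (outdeg u ℕ.* y u)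
  Laplacian-row u y = trans (sumℤ-update inflow (λ v → Laplacian G u v ℤ.* + y v) u _ off-diagonal diagonal)
                            (cong (ℤ._- + (outdeg u ℕ.* y u)) (sumℤ-pos (λ v → mult G v u ℕ.* y v)))
    where
    inflow : V G → ℤ
    inflow v = + (mult G v u ℕ.* y v)
    off-diagonal : ∀ v → v ≢ u → Laplacian G u v ℤ.* + y v ≡ inflow v
    off-diagonal v v≢u =
      trans (cong (ℤ._* + y v) (if-≢ (ℤ.- (+ outdeg v)) (+ mult G v u) (λ u≡v → v≢u (sym u≡v))))
            (sym (ℤP.pos-* (mult G v u) (y v)))
    no-loops : mult G u u ≡ 0
    no-loops = trans (sumℕ-cong (λ i → if-≢ 1 0 (loopless u i))) (sumℕ-zeros (outdeg u))
    diagonal : Laplacian G u u ℤ.* + y u ≡ inflow u ℤ.+ ℤ.- + (outdeg u ℕ.* y u)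
    diagonal = begin
      Laplacian G u u ℤ.* + y u               ≡⟨ cong (ℤ._* + y u) (if-≡ (ℤ.- (+ outdeg u)) (+ mult G u u) (refl {x = u})) ⟩
      ℤ.- (+ outdeg u) ℤ.* + y u              ≡⟨ ℤP.neg-distribˡ-* (+ outdeg u) (+ y u) ⟨
      ℤ.- (+ outdeg u ℤ.* + y u)              ≡⟨ cong ℤ.-_ (ℤP.pos-* (outdeg u) (y u)) ⟨
      ℤ.- + (outdeg u ℕ.* y u)                ≡⟨ ℤP.+-identityˡ _ ⟨
      + 0 ℤ.+ ℤ.- + (outdeg u ℕ.* y u)        ≡⟨ cong (λ z → + (z ℕ.* y u) ℤ.+ ℤ.- + (outdeg u ℕ.* y u)) no-loops ⟨
      inflow u ℤ.+ ℤ.- + (outdeg u ℕ.* y u)   ∎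
      where open ≡-Reasoning

  kernel⇒balanced : (y : V G → ℕ) → (∀ u → sumℤ (λ v → Laplacian G u v ℤ.* + y v) ≡ + 0) → Balanced y
  kernel⇒balanced y Ly≡0 u = ℤP.+-injective
    (ℤP.i-j≡0⇒i≡j _ _ (trans (sym (Laplacian-row u y)) (Ly≡0 u)))

  balanced-scale : ∀ a {y} → Balanced y → Balanced (λ v → a ℕ.* y v)
  balanced-scale a {y} bal u = begin
    sumℕ (λ w → mult G w u ℕ.* (a ℕ.* y w))   ≡⟨ sumℕ-cong (λ w → *-left-comm (mult G w u) a (y w)) ⟩
    sumℕ (λ w → a ℕ.* (mult G w u ℕ.* y w))   ≡⟨ sumℕ-*ˡ a (λ w → mult G w u ℕ.* y w) ⟩
    a ℕ.* sumℕ (λ w → mult G w u ℕ.* y w)     ≡⟨ cong (a ℕ.*_) (bal u) ⟩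
    a ℕ.* (outdeg u ℕ.* y u)                  ≡⟨ *-left-comm a (outdeg u) (y u) ⟩
    outdeg u ℕ.* (a ℕ.* y u)                  ∎
    where open ≡-Reasoning

  -- For balanced a ≤ b, agreement at the head of an edge forces agreement at its
  -- tail: the inflows at the head agree, and every term of the inflow of a is at
  -- most that of b.
  balanced-agree-backwards : ∀ {a b} → Balanced a → Balanced b → (∀ v → a v ℕ.≤ b v) →
                             ∀ v (i : Fin (outdeg v)) → a (head v i) ≡ b (head v i) → a v ≡ b v
  balanced-agree-backwards {a} {b} bal-a bal-b a≤b v i agree =
    ℕP.*-cancelˡ-≡ (a v) (b v) (mult G v u) {{ℕ.>-nonZero edge}}
      (sumℕ-squeeze (λ w → ℕP.*-monoʳ-≤ (mult G w u) (a≤b w)) inflows v)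
    where
    u : V G
    u = head v i
    inflows : sumℕ (λ w → mult G w u ℕ.* a w) ≡ sumℕ (λ w → mult G w u ℕ.* b w)
    inflows = trans (bal-a u) (trans (cong (outdeg u ℕ.*_) agree) (sym (bal-b u)))
    edge : 0 ℕ.< mult G v u
    edge = ℕP.≤-trans (ℕP.≤-reflexive (sym (if-≡ 1 0 refl))) (term≤sumℕ (hits v u) i)

  balanced-agree : StronglyConnected G → ∀ {a b} → Balanced a → Balanced b → (∀ v → a v ℕ.≤ b v) →
                   ∀ v₀ → a v₀ ≡ b v₀ → ∀ v → a v ≡ b v
  balanced-agree sc {a} {b} bal-a bal-b a≤b v₀ agree v = along (sc v v₀)
    where
    along : ∀ {v} → Reach G v v₀ → a v ≡ b v
    along here       = agree
    along (step i r) = balanced-agree-backwards bal-a bal-b a≤b _ i (along r)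

  balanced-multiple : StronglyConnected G → ∀ {P Q} → (∀ v → 0 ℕ.< P v) → NoCommonDivisor P →
                      Balanced P → Balanced Q → V G → ∃[ k ] (∀ v → Q v ≡ k ℕ.* P v)
  balanced-multiple sc {P} {Q} pos noDivisor bal-P bal-Q some-vertex =
    proportional⇒multiple P Q (P v₀) (Q v₀) {{ℕ.>-nonZero (pos v₀)}} noDivisor
      (λ v → sym (balanced-agree sc (balanced-scale (Q v₀) bal-P) (balanced-scale (P v₀) bal-Q) below v₀
                    (ℕP.*-comm (Q v₀) (P v₀)) v))
    where
    -- v₀ minimises Q/P, so Q(v₀)·P ≤ P(v₀)·Q with equality at v₀.
    v₀ : V G
    v₀ = proj₁ (minimal-ratio P Q pos some-vertex)
    below : ∀ w → Q v₀ ℕ.* P w ℕ.≤ P v₀ ℕ.* Q w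
    below w = ℕP.≤-trans (proj₂ (minimal-ratio P Q pos some-vertex) w) (ℕP.≤-reflexive (ℕP.*-comm (Q w) (P v₀)))

-- The configuration after a game depends only on how often each vertex was routed.

module Game (G : RibbonDigraph) (c : DRC G) where
  open RibbonDigraph G

  Counts : Set
  Counts = V G → ℕ

  -- The chips sent from w to u by the first j routings at w, which move the
  -- rotor of w along ρ(w)⁺, ρ(w)⁺⁺, … and fire the edge the rotor lands on.
  sent : V G → ℕ → V G → ℕ
  sent w j u = orbitSum (hits G w u) (next (rotor c w)) j

  inflow : Counts → V G → ℕ
  inflow m u = sumℕ (λ w → sent w (m w) u)

  after : Counts → DRC G
  after m = drc (λ u → div c u ℤ.- + m u ℤ.+ + inflow m u)
                (λ v → advance (m v) (rotor c v))

  bump : Counts → V G → Counts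
  bump m v u = ind u v ℕ.+ m u

  ≈-trans : ∀ {c₁ c₂ c₃} → _≈_ G c₁ c₂ → _≈_ G c₂ c₃ → _≈_ G c₁ c₃
  ≈-trans (div₁₂ , rot₁₂) (div₂₃ , rot₂₃) =
    (λ u → trans (div₁₂ u) (div₂₃ u)) , (λ u → trans (rot₁₂ u) (rot₂₃ u))

  ≈-sym : ∀ {c₁ c₂} → _≈_ G c₁ c₂ → _≈_ G c₂ c₁
  ≈-sym (div₁₂ , rot₁₂) = (λ u → sym (div₁₂ u)) , (λ u → sym (rot₁₂ u))

  after-cong : ∀ {m m'} → (∀ u → m u ≡ m' u) → _≈_ G (after m) (after m')
  after-cong {m} {m'} eq =
      (λ u → cong₂ (λ a b → div c u ℤ.- + a ℤ.+ + b) (eq u) (sumℕ-cong (λ w → cong (λ j → sent w j u) (eq w))))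
    , (λ v → cong (λ j → advance j (rotor c v)) (eq v))

  start : _≈_ G c (after (λ _ → 0))
  start = (λ u → sym (begin
            div c u ℤ.- + 0 ℤ.+ + sumℕ {n} (λ _ → 0)
              ≡⟨ cong₂ (λ a z → a ℤ.+ + z) (ℤP.+-identityʳ (div c u)) (sumℕ-zeros n) ⟩
            div c u ℤ.+ + 0
              ≡⟨ ℤP.+-identityʳ (div c u) ⟩
            div c u
              ∎))
        , (λ v → refl)
    where open ≡-Reasoning

  route-after : ∀ {c'} m v → _≈_ G c' (after m) → _≈_ G (route G c' v) (after (bump m v))
  route-after {c'} m v (div≡ , rotor≡) = divisor , rotors
    where
    e⁺ : Fin (outdeg v)
    e⁺ = advance (m v) (next (rotor c v))
    inflow-bump : ∀ u → inflow (bump m v) u ≡ inflow m u ℕ.+ ind (head v e⁺) u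
    inflow-bump u = sumℕ-update (λ w → sent w (m w) u) (λ w → sent w (bump m v w) u) v _
      (λ w w≢v → cong (λ z → sent w (z ℕ.+ m w) u) (if-≢ 1 0 w≢v))
      (trans (cong (λ z → sent v (z ℕ.+ m v) u) (if-≡ 1 0 (refl {x = v}))) (orbitSum-suc (hits G v u) (next (rotor c v)) (m v)))
    lands : ∀ u → δ u (head v (next (rotor c' v))) ≡ + ind (head v e⁺) u
    lands u = begin
      δ u (head v (next (rotor c' v)))              ≡⟨ cong (λ e → δ u (head v (next e))) (rotor≡ v) ⟩
      δ u (head v (next (advance (m v) (rotor c v)))) ≡⟨ cong (λ e → δ u (head v e)) (advance-next (m v) (rotor c v)) ⟨
      δ u (head v e⁺)                               ≡⟨ δ≡ind u (head v e⁺) ⟩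
      + ind u (head v e⁺)                           ≡⟨ cong +_ (ind-sym u (head v e⁺)) ⟩
      + ind (head v e⁺) u                           ∎
      where open ≡-Reasoning
    divisor : ∀ u → div (route G c' v) u ≡ div (after (bump m v)) u
    divisor u = begin
      div c' u ℤ.- δ u v ℤ.+ δ u (head v (next (rotor c' v)))
        ≡⟨ cong₂ (λ a e → a ℤ.- δ u v ℤ.+ e) (div≡ u) (lands u) ⟩
      div c u ℤ.- + m u ℤ.+ + inflow m u ℤ.- δ u v ℤ.+ + ind (head v e⁺) u
        ≡⟨ cong (λ b → div c u ℤ.- + m u ℤ.+ + inflow m u ℤ.- b ℤ.+ + ind (head v e⁺) u) (δ≡ind u v) ⟩
      div c u ℤ.- + m u ℤ.+ + inflow m u ℤ.- + ind u v ℤ.+ + ind (head v e⁺) u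
        ≡⟨ route-arith (div c u) (+ m u) (+ inflow m u) (+ ind u v) (+ ind (head v e⁺) u) ⟩
      div c u ℤ.- + bump m v u ℤ.+ (+ inflow m u ℤ.+ + ind (head v e⁺) u)
        ≡⟨ cong (λ z → div c u ℤ.- + bump m v u ℤ.+ + z) (inflow-bump u) ⟨
      div c u ℤ.- + bump m v u ℤ.+ + inflow (bump m v) u
        ∎
      where
      open ≡-Reasoning
      route-arith : ∀ x M S I B → x ℤ.- M ℤ.+ S ℤ.- I ℤ.+ B ≡ x ℤ.- (I ℤ.+ M) ℤ.+ (S ℤ.+ B)
      route-arith = solve-∀
    rotors : ∀ u → rotor (route G c' v) u ≡ advance (bump m v u) (rotor c u)
    rotors u with u Fin.≟ v
    ... | yes refl = cong next (rotor≡ u)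
    ... | no _     = rotor≡ u

  run-after : ∀ ws {c'} m → _≈_ G c' (after m) → _≈_ G (run G c' ws) (after (λ u → occ G u ws ℕ.+ m u))
  run-after []       m c'≈ = c'≈
  run-after (v ∷ ws) m c'≈ = ≈-trans (run-after ws (bump m v) (route-after m v c'≈))
    (after-cong (λ u → trans (sym (ℕP.+-assoc (occ G u ws) (ind u v) (m u)))
                             (cong (ℕ._+ m u) (ℕP.+-comm (occ G u ws) (ind u v)))))

  run-from-start : ∀ ws → _≈_ G (run G c ws) (after (λ u → occ G u ws))
  run-from-start ws = ≈-trans (run-after ws (λ _ → 0) start) (after-cong (λ u → ℕP.+-identityʳ (occ G u ws)))

  -- Routing every w an extra y(w) whole turns for a balanced y changes nothing:
  -- each rotor comes back, and every vertex receives exactly what it sent.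
  after-fire : ∀ {y} → Balanced G y → ∀ m → _≈_ G (after (λ w → m w ℕ.+ y w ℕ.* outdeg w)) (after m)
  after-fire {y} bal m = divisor , rotors
    where
    m' : Counts
    m' w = m w ℕ.+ y w ℕ.* outdeg w
    rotors : ∀ v → advance (m' v) (rotor c v) ≡ advance (m v) (rotor c v)
    rotors v = trans (sym (advance-+ (m v) (y v ℕ.* outdeg v) (rotor c v)))
                     (cong (advance (m v)) (advance-turns (y v) (rotor c v)))
    inflow-fire : ∀ u → inflow m' u ≡ inflow m u ℕ.+ y u ℕ.* outdeg u
    inflow-fire u = begin
      sumℕ (λ w → sent w (m' w) u)
        ≡⟨ sumℕ-cong (λ w → orbitSum-turns (hits G w u) _ (m w) (y w)) ⟩
      sumℕ (λ w → sent w (m w) u ℕ.+ y w ℕ.* mult G w u)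
        ≡⟨ sumℕ-+ (λ w → sent w (m w) u) _ ⟩
      inflow m u ℕ.+ sumℕ (λ w → y w ℕ.* mult G w u)
        ≡⟨ cong (inflow m u ℕ.+_) (sumℕ-cong (λ w → ℕP.*-comm (y w) _)) ⟩
      inflow m u ℕ.+ sumℕ (λ w → mult G w u ℕ.* y w)
        ≡⟨ cong (inflow m u ℕ.+_) (trans (bal u) (ℕP.*-comm (outdeg u) (y u))) ⟩
      inflow m u ℕ.+ y u ℕ.* outdeg u
        ∎
      where open ≡-Reasoning
    divisor : ∀ u → div (after m') u ≡ div (after m) u
    divisor u = trans (cong (λ z → div c u ℤ.- + m' u ℤ.+ + z) (inflow-fire u))
                      (cancel (div c u) (+ m u) (+ inflow m u) (+ (y u ℕ.* outdeg u)))
      where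
      cancel : ∀ x M I K → x ℤ.- (M ℤ.+ K) ℤ.+ (I ℤ.+ K) ≡ x ℤ.- M ℤ.+ I
      cancel = solve-∀

  chips-return : ∀ x a b → x ℤ.- + a ℤ.+ + b ≡ x → a ≡ b
  chips-return x a b back = ℤP.+-injective (sym (ℤP.i-j≡0⇒i≡j (+ b) (+ a)
                              (trans (rearrange x (+ a) (+ b)) (ℤP.i≡j⇒i-j≡0 back))))
    where
    rearrange : ∀ x a b → b ℤ.- a ≡ x ℤ.- a ℤ.+ b ℤ.- x
    rearrange = solve-∀

  returning-turns : ∀ ws → _≈_ G (run G c ws) c →
                    ∃[ Q ] ((∀ v → occ G v ws ≡ Q v ℕ.* outdeg v) × Balanced G Q)
  returning-turns ws returns = Q , turns , balanced
    where
    o : Counts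
    o u = occ G u ws
    back : _≈_ G (after o) c
    back = ≈-trans (≈-sym (run-from-start ws)) returns
    whole-turns : ∀ v → ∃[ q ] o v ≡ q ℕ.* outdeg v
    whole-turns v = advance-returns (o v) (rotor c v) (proj₂ back v)
    Q : Counts
    Q v = proj₁ (whole-turns v)
    turns : ∀ v → o v ≡ Q v ℕ.* outdeg v
    turns v = proj₂ (whole-turns v)
    balanced : Balanced G Q
    balanced u = begin
      sumℕ (λ w → mult G w u ℕ.* Q w)                 ≡⟨ sumℕ-cong (λ w → ℕP.*-comm (mult G w u) (Q w)) ⟩
      sumℕ (λ w → Q w ℕ.* mult G w u)                 ≡⟨ sumℕ-cong (λ w → orbitSum-turns (hits G w u) _ 0 (Q w)) ⟨
      sumℕ (λ w → sent w (Q w ℕ.* outdeg w) u)        ≡⟨ sumℕ-cong (λ w → cong (λ j → sent w j u) (turns w)) ⟨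
      inflow o u                                      ≡⟨ chips-return (div c u) (o u) (inflow o u) (proj₁ back u) ⟨
      o u                                             ≡⟨ turns u ⟩
      Q u ℕ.* outdeg u                                ≡⟨ ℕP.*-comm (Q u) (outdeg u) ⟩
      outdeg u ℕ.* Q u                                ∎
      where open ≡-Reasoning

  after-mono : ∀ m m' v → (∀ w → m w ℕ.≤ m' w) → m v ≡ m' v → div (after m) v ℤ.≤ div (after m') v
  after-mono m m' v m≤m' same = subst (λ z → div c v ℤ.- + z ℤ.+ + inflow m v ℤ.≤ div (after m') v) (sym same)
    (ℤP.+-monoʳ-≤ (div c v ℤ.- + m' v) (ℤ.+≤+ (sumℕ-mono (λ w → orbitSum-mono (hits G w v) _ (m≤m' w)))))

  IsPeriod : Counts → Set
  IsPeriod t = ∀ m → _≈_ G (after (λ w → m w ℕ.+ t w)) (after m)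

  -- dropFirst t p ws deletes from ws every routing at a vertex v performed while v
  -- has been routed fewer than t(v) times, p(v) being the count before ws.
  dropFirst : Counts → Counts → List (V G) → List (V G)
  dropFirst t p [] = []
  dropFirst t p (v ∷ ws) with p v ℕ.<? t v
  ... | yes _ = dropFirst t (bump p v) ws
  ... | no _  = v ∷ dropFirst t (bump p v) ws

  -- The counts p ∸ t of the shortened game advance only at kept routings.
  bump-∸-dropped : ∀ (t p : Counts) v → p v ℕ.< t v → ∀ u → bump p v u ∸ t u ≡ p u ∸ t u
  bump-∸-dropped t p v p<t u with u Fin.≟ v
  ... | yes refl = trans (ℕP.m≤n⇒m∸n≡0 p<t) (sym (ℕP.m≤n⇒m∸n≡0 (ℕP.<⇒≤ p<t)))
  ... | no _     = refl

  bump-∸-kept : ∀ (t p : Counts) v → ¬ p v ℕ.< t v → ∀ u → bump p v u ∸ t u ≡ bump (λ w → p w ∸ t w) v u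
  bump-∸-kept t p v p≮t u with u Fin.≟ v
  ... | yes refl = ℕP.+-∸-assoc 1 (ℕP.≮⇒≥ p≮t)
  ... | no _     = refl

  occ-dropFirst : ∀ (t : Counts) ws (p : Counts) u → occ G u (dropFirst t p ws) ℕ.+ (p u ∸ t u) ≡ (occ G u ws ℕ.+ p u) ∸ t u
  occ-dropFirst t []       p u = refl
  occ-dropFirst t (v ∷ ws) p u with p v ℕ.<? t v
  ... | yes p<t = begin
    rest ℕ.+ (p u ∸ t u)                 ≡⟨ cong (rest ℕ.+_) (bump-∸-dropped t p v p<t u) ⟨
    rest ℕ.+ (bump p v u ∸ t u)          ≡⟨ occ-dropFirst t ws (bump p v) u ⟩
    (occ G u ws ℕ.+ bump p v u) ∸ t u    ≡⟨ cong (_∸ t u) (+-assoc-comm (occ G u ws) (ind u v) (p u)) ⟩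
    (occ G u (v ∷ ws) ℕ.+ p u) ∸ t u     ∎
    where
    open ≡-Reasoning
    rest : ℕ
    rest = occ G u (dropFirst t (bump p v) ws)
  ... | no p≮t = begin
    ind u v ℕ.+ rest ℕ.+ (p u ∸ t u)        ≡⟨ +-comm-assoc (ind u v) rest (p u ∸ t u) ⟩
    rest ℕ.+ bump (λ w → p w ∸ t w) v u     ≡⟨ cong (rest ℕ.+_) (bump-∸-kept t p v p≮t u) ⟨
    rest ℕ.+ (bump p v u ∸ t u)             ≡⟨ occ-dropFirst t ws (bump p v) u ⟩
    (occ G u ws ℕ.+ bump p v u) ∸ t u       ≡⟨ cong (_∸ t u) (+-assoc-comm (occ G u ws) (ind u v) (p u)) ⟩
    (occ G u (v ∷ ws) ℕ.+ p u) ∸ t u        ∎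
    where
    open ≡-Reasoning
    rest : ℕ
    rest = occ G u (dropFirst t (bump p v) ws)

  -- Dropping the first t(v) routings at every v keeps a game legal when t is a
  -- period: a kept routing at v happens in a configuration with at least as
  -- many chips at v as in the original game, since v has been routed equally
  -- often (modulo the period) and every other vertex at least as often.
  legal-dropFirst : ∀ {t} → IsPeriod t → ∀ ws (p : Counts) {c₁ c₂} →
                    _≈_ G c₁ (after p) → _≈_ G c₂ (after (λ u → p u ∸ t u)) →
                    Legal G c₁ ws → Legal G c₂ (dropFirst t p ws)
  legal-dropFirst {t} period []       p c₁≈ c₂≈ legal = tt
  legal-dropFirst {t} period (v ∷ ws) p {c₁} {c₂} c₁≈ c₂≈ (positive , legal) with p v ℕ.<? t v
  ... | yes p<t = legal-dropFirst period ws (bump p v) (route-after p v c₁≈)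
                    (≈-trans c₂≈ (after-cong (λ u → sym (bump-∸-dropped t p v p<t u)))) legal
  ... | no p≮t  = enough-chips , legal-dropFirst period ws (bump p v) (route-after p v c₁≈)
                    (≈-trans (route-after (λ u → p u ∸ t u) v c₂≈)
                             (after-cong (λ u → sym (bump-∸-kept t p v p≮t u))))
                    legal
    where
    p′ : Counts
    p′ u = p u ∸ t u
    enough-chips : + 0 ℤ.< div c₂ v
    enough-chips = begin-strict
      + 0                             <⟨ positive ⟩
      div c₁ v                        ≡⟨ proj₁ c₁≈ v ⟩
      div (after p) v                 ≤⟨ after-mono p (λ u → p′ u ℕ.+ t u) v p≤p′+t (sym (ℕP.m∸n+n≡m (ℕP.≮⇒≥ p≮t))) ⟩
      div (after (λ u → p′ u ℕ.+ t u)) v ≡⟨ proj₁ (period p′) v ⟩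
      div (after p′) v                ≡⟨ proj₁ c₂≈ v ⟨
      div c₂ v                        ∎
      where
      open ℤP.≤-Reasoning
      p≤p′+t : ∀ u → p u ℕ.≤ p′ u ℕ.+ t u
      p≤p′+t u = ℕP.≤-trans (ℕP.m≤n+m∸n (p u) (t u)) (ℕP.≤-reflexive (ℕP.+-comm (t u) (p′ u)))

-- Games returning to a configuration.

module Returns (G : RibbonDigraph) (sc : StronglyConnected G) (per : V G → ℤ) (isPer : IsPer G per)
               (c : DRC G) where
  open RibbonDigraph G
  open Game G c

  P : V G → ℕ
  P v = ℤ.∣ per v ∣

  per≡P : ∀ v → per v ≡ + P v
  per≡P v = sym (ℤP.0≤i⇒+∣i∣≡i (ℤP.<⇒≤ (proj₁ isPer v)))

  P-positive : ∀ v → 0 ℕ.< P v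
  P-positive v = ℤP.drop‿+<+ (subst (+ 0 ℤ.<_) (per≡P v) (proj₁ isPer v))

  P-balanced : Balanced G P
  P-balanced = kernel⇒balanced G P (λ u →
    trans (sumℤ-cong (λ v → cong (Laplacian G u v ℤ.*_) (sym (per≡P v)))) (proj₂ (proj₂ isPer) u))

  turn : V G → ℕ
  turn v = outdeg v ℕ.* P v

  turn≡ : ∀ v → + turn v ≡ + outdeg v ℤ.* per v
  turn≡ v = trans (ℤP.pos-* (outdeg v) (P v)) (cong (+ outdeg v ℤ.*_) (sym (per≡P v)))

  turns-period : ∀ s → IsPeriod (λ w → s ℕ.* turn w)
  turns-period s m = ≈-trans (after-cong (λ w → cong (m w ℕ.+_) (reorder s (outdeg w) (P w))))
                             (after-fire (balanced-scale G s P-balanced) m)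
    where
    reorder : ∀ s d p → s ℕ.* (d ℕ.* p) ≡ s ℕ.* p ℕ.* d
    reorder = ℕ-solve-∀

  returning-multiples : ∀ ws → ws ≢ [] → _≈_ G (run G c ws) c → ∃[ k ] (∀ v → occ G v ws ≡ k ℕ.* turn v)
  returning-multiples []       nonempty returns = contradiction refl nonempty
  returning-multiples (v ∷ ws) _        returns = k , counts
    where
    open ≡-Reasoning
    turns : ∃[ Q ] ((∀ u → occ G u (v ∷ ws) ≡ Q u ℕ.* outdeg u) × Balanced G Q)
    turns = returning-turns (v ∷ ws) returns
    Q : Counts
    Q = proj₁ turns
    multiple : ∃[ k ] (∀ u → Q u ≡ k ℕ.* P u)
    multiple = balanced-multiple G sc P-positive (proj₁ (proj₂ isPer)) P-balanced (proj₂ (proj₂ turns)) v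
    k : ℕ
    k = proj₁ multiple
    reorder : ∀ k p d → k ℕ.* p ℕ.* d ≡ k ℕ.* (d ℕ.* p)
    reorder = ℕ-solve-∀
    counts : ∀ u → occ G u (v ∷ ws) ≡ k ℕ.* turn u
    counts u = begin
      occ G u (v ∷ ws)         ≡⟨ proj₁ (proj₂ turns) u ⟩
      Q u ℕ.* outdeg u         ≡⟨ cong (ℕ._* outdeg u) (proj₂ multiple u) ⟩
      k ℕ.* P u ℕ.* outdeg u   ≡⟨ reorder k (P u) (outdeg u) ⟩
      k ℕ.* turn u             ∎

  shorten : ∀ s ws → Legal G c ws → (∀ u → occ G u ws ≡ suc s ℕ.* turn u) →
            ∃[ ws′ ] (Legal G c ws′ × _≈_ G (run G c ws′) c × (∀ u → occ G u ws′ ≡ turn u))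
  shorten s ws legal counts = ws′ , legal′ , returns′ , counts′
    where
    t : Counts
    t u = s ℕ.* turn u
    ws′ : List (V G)
    ws′ = dropFirst t (λ _ → 0) ws
    legal′ : Legal G c ws′
    legal′ = legal-dropFirst (turns-period s) ws (λ _ → 0) start
               (≈-trans start (after-cong (λ u → sym (ℕP.0∸n≡0 (t u))))) legal
    counts′ : ∀ u → occ G u ws′ ≡ turn u
    counts′ u = begin
      occ G u ws′                       ≡⟨ ℕP.+-identityʳ _ ⟨
      occ G u ws′ ℕ.+ 0                 ≡⟨ cong (occ G u ws′ ℕ.+_) (ℕP.0∸n≡0 (t u)) ⟨
      occ G u ws′ ℕ.+ (0 ∸ t u)         ≡⟨ occ-dropFirst t ws (λ _ → 0) u ⟩
      (occ G u ws ℕ.+ 0) ∸ t u          ≡⟨ cong (_∸ t u) (trans (ℕP.+-identityʳ _) (counts u)) ⟩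
      (turn u ℕ.+ t u) ∸ t u            ≡⟨ ℕP.m+n∸n≡m (turn u) (t u) ⟩
      turn u                            ∎
      where open ≡-Reasoning
    returns′ : _≈_ G (run G c ws′) c
    returns′ = ≈-trans (run-from-start ws′)
              (≈-trans (after-cong (λ u → trans (counts′ u) (sym (ℕP.*-identityˡ (turn u)))))
              (≈-trans (turns-period 1 (λ _ → 0)) (≈-sym start)))

  -- Second part: a legal game returning to c can be shortened to one that
  -- routes every v exactly turn(v) times; its multiple k is nonzero since the
  -- first vertex of the game is routed.
  one-period-return : ∀ ws → ws ≢ [] → Legal G c ws → _≈_ G (run G c ws) c →
                      ∃[ ws′ ] (Legal G c ws′ × _≈_ G (run G c ws′) c × (∀ u → occ G u ws′ ≡ turn u))
  one-period-return []       nonempty _     _       = contradiction refl nonempty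
  one-period-return (v ∷ ws) nonempty legal returns = from-multiple (returning-multiples (v ∷ ws) nonempty returns)
    where
    from-multiple : ∃[ k ] (∀ u → occ G u (v ∷ ws) ≡ k ℕ.* turn u) →
                    ∃[ ws′ ] (Legal G c ws′ × _≈_ G (run G c ws′) c × (∀ u → occ G u ws′ ≡ turn u))
    from-multiple (zero  , counts) = contradiction (trans first-routed (counts v)) ℕP.1+n≢0
      where
      first-routed : suc (occ G v ws) ≡ occ G v (v ∷ ws)
      first-routed = cong (ℕ._+ occ G v ws) (sym (if-≡ 1 0 (refl {x = v})))
    from-multiple (suc s , counts) = shorten s (v ∷ ws) legal counts

  multiple-in-ℤ : ∀ {n} k v → n ≡ k ℕ.* turn v → + n ≡ + k ℤ.* (+ outdeg v ℤ.* per v)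
  multiple-in-ℤ k v refl = trans (ℤP.pos-* k (turn v)) (cong (+ k ℤ.*_) (turn≡ v))

proposition2p6 : (G : RibbonDigraph) → StronglyConnected G →
    (per : V G → ℤ) → IsPer G per →
    (c : DRC G) → Recurrent G c →
    ((ws : List (V G)) → ws ≢ [] → Legal G c ws → _≈_ G (run G c ws) c →
      ∃[ k ] (∀ v → + occ G v ws ≡ + k * (+ RibbonDigraph.outdeg G v * per v)))
    × (∃[ ws ] (Legal G c ws × _≈_ G (run G c ws) c ×
      (∀ v → + occ G v ws ≡ + RibbonDigraph.outdeg G v * per v)))
proposition2p6 G sc per isPer c (ws₀ , nonempty₀ , legal₀ , returns₀) = multiples , one-period
  where
  open Returns G sc per isPer c

  multiples : (ws : List (V G)) → ws ≢ [] → Legal G c ws → _≈_ G (run G c ws) c →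
              ∃[ k ] (∀ v → + occ G v ws ≡ + k * (+ RibbonDigraph.outdeg G v * per v))
  multiples ws nonempty _ returns with returning-multiples ws nonempty returns
  ... | k , counts = k , λ v → multiple-in-ℤ k v (counts v)

  one-period : ∃[ ws ] (Legal G c ws × _≈_ G (run G c ws) c × (∀ v → + occ G v ws ≡ + RibbonDigraph.outdeg G v * per v))
  one-period with one-period-return ws₀ nonempty₀ legal₀ returns₀
  ... | ws , legal , returns , counts = ws , legal , returns , λ v → trans (cong +_ (counts v)) (turn≡ v)
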